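{- Let $G$ be a finite abelian group such that $G$ is not isomorphic to the Klein four-group $C_2 \oplus C_2$. Then $\operatorname{Aut}(\mathcal{P}_{0}(G)) \simeq \operatorname{Aut}(G)$.
   Context: For an additively written finite abelian group $G$, $\mathcal{P}_{0}(G)$ denotes the reduced power monoid of $G$: the set of all subsets of $G$ containing $0$, with the operation of setwise addition $X+Y=\{x+y : x\in X, y\in Y\}$ and identity $\{0\}$. $\operatorname{Aut}$ denotes the group of monoid (resp. group) automorphisms. $C_k$ denotes the cyclic group of order $k$. -}

module Defs where

open import Level using (0ℓ)
open import Data.Nat using (ℕ; zero; suc)
open import Data.Fin using (Fin; zero; suc; _≟_)
open import Data.Fin.Subset using (Subset; _∈_; ⁅_⁆)
open import Data.Fin.Subset.Properties using (x∈⁅x⁆)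
open import Data.Vec using (lookup; tabulate)
open import Data.Vec.Properties using (lookup∘tabulate; []=⇒lookup; lookup⇒[]=)
open import Data.Bool using (Bool; true; false; _∧_; _∨_; _xor_)
open import Data.Bool.Properties using (xor-assoc; xor-comm; xor-identityˡ; xor-identityʳ; xor-same)
open import Data.Product using (Σ; _,_; proj₁; proj₂; ∃)
open import Relation.Nullary using (yes; no)
open import Data.Empty using (⊥-elim)
open import Relation.Nullary.Decidable using (⌊_⌋)
open import Relation.Binary.PropositionalEquality
open import Function using (id; _∘_)
open import Function.Definitions using (Bijective; Injective; Surjective)
open import Algebra.Core using (Op₁; Op₂)
open import Algebra.Bundles using (AbelianGroup)
open import Algebra.Structures using (IsAbelianGroup)
open import Algebra.Construct.DirectProduct using (abelianGroup)

-- A finite abelian group, presented (up to isomorphism) with carrier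
-- Fin n and propositional equality as the group equality.

record FinAbGroup (n : ℕ) : Set where
  field
    _∙_ : Op₂ (Fin n)
    ε   : Fin n
    _⁻¹ : Op₁ (Fin n)
    isAbelianGroup : IsAbelianGroup _≡_ _∙_ ε _⁻¹
  open IsAbelianGroup isAbelianGroup public
    using (identityˡ)

record GroupIso {n : ℕ} (G : FinAbGroup n) (H : AbelianGroup 0ℓ 0ℓ) : Set where
  module G = FinAbGroup G
  module H = AbelianGroup H
  field
    φ       : Fin n → H.Carrier
    φ-hom   : ∀ x y → φ (x G.∙ y) H.≈ (φ x H.∙ φ y)
    φ-bij   : Bijective _≡_ H._≈_ φ

C₂-isAbelianGroup : IsAbelianGroup _≡_ _xor_ false id
C₂-isAbelianGroup = record
  { isGroup = record
    { isMonoid = record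
      { isSemigroup = record
        { isMagma = record { isEquivalence = isEquivalence ; ∙-cong = cong₂ _xor_ }
        ; assoc = xor-assoc }
      ; identity = xor-identityˡ , xor-identityʳ }
    ; inverse = xor-same , xor-same
    ; ⁻¹-cong = cong id }
  ; comm = xor-comm }

C₂ : AbelianGroup 0ℓ 0ℓ
C₂ = record { isAbelianGroup = C₂-isAbelianGroup }

KleinFour : AbelianGroup 0ℓ 0ℓ
KleinFour = abelianGroup C₂ C₂

anyFin : ∀ {n} → (Fin n → Bool) → Bool
anyFin {zero}  f = false
anyFin {suc n} f = f zero ∨ anyFin (f ∘ suc)

anyFin-intro : ∀ {n} (f : Fin n → Bool) (i : Fin n) → f i ≡ true → anyFin f ≡ true
anyFin-intro f zero    eq rewrite eq = refl
anyFin-intro f (suc i) eq with f zero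
... | true  = refl
... | false = anyFin-intro (f ∘ suc) i eq

module _ {n : ℕ} (G : FinAbGroup n) where
  open FinAbGroup G

  sumset : Subset n → Subset n → Subset n
  sumset X Y = tabulate λ z →
    anyFin λ x → anyFin λ y → lookup X x ∧ lookup Y y ∧ ⌊ z ≟ (x ∙ y) ⌋

  P₀ : Set
  P₀ = Σ (Subset n) (λ X → ε ∈ X)

  _≈P_ : P₀ → P₀ → Set
  X ≈P Y = proj₁ X ≡ proj₁ Y

  private
    ≟-refl : ∀ (z : Fin n) → ⌊ z ≟ z ⌋ ≡ true
    ≟-refl z with z ≟ z
    ... | yes _ = refl
    ... | no ¬p = ⊥-elim (¬p refl)

    ε∈sum : (X Y : Subset n) → ε ∈ X → ε ∈ Y → ε ∈ sumset X Y
    ε∈sum X Y εX εY = lookup⇒[]= ε (sumset X Y)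
      (trans (lookup∘tabulate _ ε)
        (anyFin-intro _ ε (anyFin-intro _ ε
          (subst (λ w → lookup X ε ∧ lookup Y ε ∧ ⌊ ε ≟ w ⌋ ≡ true)
            (sym (identityˡ ε))
            (subst₂ (λ a b → a ∧ b ∧ ⌊ ε ≟ ε ⌋ ≡ true)
              (sym ([]=⇒lookup εX)) (sym ([]=⇒lookup εY)) (≟-refl ε))))))

  _⊞_ : P₀ → P₀ → P₀
  (X , εX) ⊞ (Y , εY) = sumset X Y , ε∈sum X Y εX εY

  𝟘 : P₀
  𝟘 = ⁅ ε ⁆ , x∈⁅x⁆ ε

  record AutG : Set where
    field
      f     : Fin n → Fin n
      f-hom : ∀ x y → f (x ∙ y) ≡ f x ∙ f y
      f-bij : Bijective _≡_ _≡_ f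
  open AutG public

  record AutP₀ : Set where
    field
      F     : P₀ → P₀
      F-cong : ∀ X Y → X ≈P Y → F X ≈P F Y
      F-hom : ∀ X Y → F (X ⊞ Y) ≈P (F X ⊞ F Y)
      F-id  : F 𝟘 ≈P 𝟘
      F-bij : Bijective _≈P_ _≈P_ F
  open AutP₀ public

  _≈G_ : AutG → AutG → Set
  σ ≈G τ = ∀ x → f σ x ≡ f τ x

  _≈A_ : AutP₀ → AutP₀ → Set
  Φ ≈A Ψ = ∀ X → F Φ X ≈P F Ψ X

  -- Aut(G) ≅ Aut(P₀(G)) as groups: a bijective map Θ compatible with
  -- composition (composition expressed via the underlying functions).
  record AutIso : Set where
    field
      Θ       : AutG → AutP₀
      Θ-cong  : ∀ σ τ → σ ≈G τ → Θ σ ≈A Θ τ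
      Θ-hom   : ∀ σ τ ρ → (∀ x → f ρ x ≡ f σ (f τ x)) →
                ∀ X → F (Θ ρ) X ≈P F (Θ σ) (F (Θ τ) X)
      Θ-inj   : ∀ σ τ → Θ σ ≈A Θ τ → σ ≈G τ
      Θ-surj  : ∀ Φ → ∃ λ σ → Θ σ ≈A Φ

module Submission where

-- Write G additively. The maximal elements of P₀(G) are exactly the co-atoms G ∖ {g}, g ≠ 0, so an
-- automorphism Φ of P₀(G) induces a permutation τ of G with Φ(G ∖ {g}) = G ∖ {τ g}. An aperiodic
-- set Z divides G ∖ {g} precisely when g ∉ Z, hence Φ Z = τ(Z) for aperiodic Z. Every y ∈ X lies in
-- an aperiodic divisor of X, unless X = {0, y} with 2y = 0. These exceptional sets are the
-- two-element subgroups, which Φ permutes; if Φ{0, y} = {0, k} with k ≠ τ y, then either {0, τ⁻¹ k}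
-- is aperiodic and Φ would identify it with {0, y}, or G = {0, y, τ⁻¹ k, y + τ⁻¹ k} is the Klein
-- four-group. So Φ X = τ(X) for all X, and comparing Φ({0, x} + {0, y}) with τ({0, x} + {0, y})
-- shows that τ is additive. Conversely each σ ∈ Aut(G) acts on P₀(G) by taking images.

open import Defs
open import Data.Nat using (ℕ)
open import Relation.Nullary using (¬_)

open import Level using (0ℓ)
open import Data.Nat using (zero; suc; _+_)
open import Data.Nat.Properties using (n<1+n; m≤n⇒∃[o]m+o≡n; +-suc)
open import Data.Fin using (Fin; zero; suc; toℕ; _≟_)
open import Data.Fin.Properties using (any?; all?; pigeonhole)
open import Data.Fin.Subset using (Subset; _∈_; _∉_; _⊆_; ⁅_⁆; ⊤; ∁; _∪_; _∩_)
open import Data.Fin.Subset.Properties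
  using (_∈?_; ⊆-antisym; ⊆-reflexive; ∈⊤; x∈⁅x⁆; x∈⁅y⁆⇒x≡y; x≢y⇒x∉⁅y⁆; x∉⁅y⁆⇒x≢y;
         x∈∁p⇒x∉p; x∉p⇒x∈∁p; x∈p∪q⁺; x∈p∪q⁻; x∈p∩q⁺; x∈p∩q⁻)
import Data.Fin.Permutation as Perm
open Perm using (Permutation′; _⟨$⟩ʳ_; _⟨$⟩ˡ_; _∘ₚ_)
open import Data.Vec using (lookup; tabulate)
open import Data.Vec.Properties using (lookup∘tabulate; tabulate-cong; []=⇒lookup; lookup⇒[]=)
open import Data.Bool using (Bool; true; false; _∧_; _xor_)
open import Data.Bool.Properties using (xor-same)
open import Data.Product.Relation.Binary.Pointwise.NonDependent using (≡⇒≡×≡; ≡×≡⇒≡)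
open import Data.Product using (∃; ∃₂; _×_; _,_; proj₁; proj₂)
import Data.Product as Product
open import Data.Sum using (_⊎_; inj₁; inj₂)
import Data.Sum as Sum
open import Data.Empty using (⊥)
open import Relation.Nullary using (Dec; yes; no; contradiction)
open import Relation.Nullary.Decidable using (isYes; map′; ¬?; _×-dec_; _→-dec_; decidable-stable)
open import Relation.Binary.PropositionalEquality
open import Function using (_∘_; id)
open import Function.Bundles using (Injection; mk⤖)
open import Function.Properties.Inverse using (↔⇒↣)
open import Function.Properties.Bijection using (⤖⇒↔)
open import Algebra.Bundles using (AbelianGroup)
import Algebra.Properties.Group as GroupProperties
import Algebra.Properties.CommutativeSemigroup as CommutativeSemigroupProperties
import Algebra.Definitions.RawMonoid as RawMonoidDefinitions
import Algebra.Properties.Monoid.Mult as MonoidMultProperties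
open import Relation.Unary using (Pred; Decidable)

private
  variable
    m : ℕ

∧-true⁺ : ∀ {a b} → a ≡ true → b ≡ true → a ∧ b ≡ true
∧-true⁺ refl refl = refl

∧-true⁻ : ∀ a {b} → a ∧ b ≡ true → a ≡ true × b ≡ true
∧-true⁻ true b≡true = refl , b≡true

isYes-true⁺ : ∀ {A : Set} (a? : Dec A) → A → isYes a? ≡ true
isYes-true⁺ (yes _) _ = refl
isYes-true⁺ (no ¬a) a = contradiction a ¬a

isYes-true⁻ : ∀ {A : Set} (a? : Dec A) → isYes a? ≡ true → A
isYes-true⁻ (yes a) _ = a

anyFin-elim : (f : Fin m → Bool) → anyFin f ≡ true → ∃ λ i → f i ≡ true
anyFin-elim {suc m} f any≡true with f zero in eq
... | true  = zero , eq
... | false = Product.map suc id (anyFin-elim (f ∘ suc) any≡true)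

∈-tabulate⁺ : ∀ {f : Fin m → Bool} {x} → f x ≡ true → x ∈ tabulate f
∈-tabulate⁺ {f = f} {x} fx≡true = lookup⇒[]= x _ (trans (lookup∘tabulate f x) fx≡true)

∈-tabulate⁻ : ∀ {f : Fin m → Bool} {x} → x ∈ tabulate f → f x ≡ true
∈-tabulate⁻ {f = f} {x} x∈ = trans (sym (lookup∘tabulate f x)) ([]=⇒lookup x∈)

satisfying : ∀ {P : Pred (Fin m) 0ℓ} → Decidable P → Subset m
satisfying P? = tabulate (isYes ∘ P?)

module _ {P : Pred (Fin m) 0ℓ} (P? : Decidable P) {x : Fin m} where

  ∈-satisfying⁺ : P x → x ∈ satisfying P?
  ∈-satisfying⁺ = ∈-tabulate⁺ ∘ isYes-true⁺ (P? x)

  ∈-satisfying⁻ : x ∈ satisfying P? → P x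
  ∈-satisfying⁻ = isYes-true⁻ (P? x) ∘ ∈-tabulate⁻

⟨$⟩ʳ-injective : ∀ (π : Permutation′ m) {a b} → π ⟨$⟩ʳ a ≡ π ⟨$⟩ʳ b → a ≡ b
⟨$⟩ʳ-injective π = Injection.injective (↔⇒↣ π)

image : Permutation′ m → Subset m → Subset m
image π X = tabulate (λ y → lookup X (π ⟨$⟩ˡ y))

module _ (π : Permutation′ m) {X : Subset m} where

  ∈-image⁺ : ∀ {y} → π ⟨$⟩ˡ y ∈ X → y ∈ image π X
  ∈-image⁺ = ∈-tabulate⁺ ∘ []=⇒lookup

  ∈-image-apply : ∀ {x} → x ∈ X → π ⟨$⟩ʳ x ∈ image π X
  ∈-image-apply x∈X = ∈-image⁺ (subst (_∈ X) (sym (Perm.inverseˡ π)) x∈X)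

∈-image⁻ : ∀ (π : Permutation′ m) X {y} → y ∈ image π X → π ⟨$⟩ˡ y ∈ X
∈-image⁻ π X = lookup⇒[]= _ X ∘ ∈-tabulate⁻

image-cong : ∀ (π ρ : Permutation′ m) → (∀ x → π ⟨$⟩ʳ x ≡ ρ ⟨$⟩ʳ x) → ∀ X → image π X ≡ image ρ X
image-cong π ρ π≗ρ X = tabulate-cong λ y → cong (lookup X) (inverses-agree y)
  where
  inverses-agree : ∀ y → π ⟨$⟩ˡ y ≡ ρ ⟨$⟩ˡ y
  inverses-agree y = trans (sym (Perm.inverseˡ ρ)) (cong (ρ ⟨$⟩ˡ_) (trans (sym (π≗ρ _)) (Perm.inverseʳ π)))

image-∘ₚ : ∀ (π ρ : Permutation′ m) X → image (π ∘ₚ ρ) X ≡ image ρ (image π X)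
image-∘ₚ π ρ X = tabulate-cong λ y → sym (lookup∘tabulate _ (ρ ⟨$⟩ˡ y))

image-flipˡ : ∀ (π : Permutation′ m) X → image (Perm.flip π) (image π X) ≡ X
image-flipˡ π X = ⊆-antisym
  (λ x∈ → subst (_∈ X) (Perm.inverseˡ π) (∈-image⁻ π X (∈-image⁻ (Perm.flip π) (image π X) x∈)))
  (λ x∈X → ∈-image⁺ (Perm.flip π) (∈-image-apply π x∈X))

image-flipʳ : ∀ (π : Permutation′ m) X → image π (image (Perm.flip π) X) ≡ X
image-flipʳ π X = ⊆-antisym
  (λ y∈ → subst (_∈ X) (Perm.inverseʳ π) (∈-image⁻ (Perm.flip π) X (∈-image⁻ π (image (Perm.flip π) X) y∈)))
  (λ y∈X → ∈-image⁺ π (∈-image-apply (Perm.flip π) y∈X))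

module _ {n : ℕ} (G : FinAbGroup n) where
  open FinAbGroup G using (isAbelianGroup)

  private
    abelianGroup : AbelianGroup 0ℓ 0ℓ
    abelianGroup = record { isAbelianGroup = isAbelianGroup }

  open AbelianGroup abelianGroup
    using (_∙_; ε; _⁻¹; assoc; comm; identityˡ; identityʳ;
           group; monoid; rawMonoid; commutativeSemigroup)
  open GroupProperties group
    using (∙-cancelʳ; identityˡ-unique; identityʳ-unique; inverseˡ-unique; inverseʳ-unique;
           x≈z//y; y≈x\\z; x∙y⁻¹≈ε⇒x≈y; \\-leftDividesˡ; //-rightDividesˡ; ⁻¹-injective; ε⁻¹≈ε)
  open RawMonoidDefinitions rawMonoid using () renaming (_×_ to _·_)
  open MonoidMultProperties monoid using (×-homo-+)
  open CommutativeSemigroupProperties commutativeSemigroup using (interchange)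

  Involution : Fin n → Set
  Involution y = y ≢ ε × y ∙ y ≡ ε

  involution-selfInverse : ∀ {y} → y ∙ y ≡ ε → y ⁻¹ ≡ y
  involution-selfInverse {y} yy≡ε = sym (inverseʳ-unique y y yy≡ε)

  ⁻¹≡ε⇒≡ε : ∀ {x} → x ⁻¹ ≡ ε → x ≡ ε
  ⁻¹≡ε⇒≡ε x⁻¹≡ε = ⁻¹-injective (trans x⁻¹≡ε (sym ε⁻¹≈ε))

  x∙y≢x : ∀ x {y} → y ≢ ε → x ∙ y ≢ x
  x∙y≢x x y≢ε xy≡x = y≢ε (identityʳ-unique x _ xy≡x)

  -- Membership in an element of 𝒫 only depends on its underlying subset, and an element of 𝒫 cannot
  -- be inferred from a membership proof: membership lemmas are therefore stated for subsets, and
  -- elements of 𝒫 are passed explicitly.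
  𝒫 : Set
  𝒫 = P₀ G

  infix 4 _∈ₚ_ _∉ₚ_ _≈_
  infixl 6 _⊕_

  _∈ₚ_ _∉ₚ_ : Fin n → 𝒫 → Set
  x ∈ₚ X = x ∈ proj₁ X
  x ∉ₚ X = x ∉ proj₁ X

  _≈_ : 𝒫 → 𝒫 → Set
  _≈_ = _≈P_ G

  _⊕_ : 𝒫 → 𝒫 → 𝒫
  _⊕_ = _⊞_ G

  𝟎 : 𝒫
  𝟎 = 𝟘 G

  ∈ₚ? : ∀ x X → Dec (x ∈ₚ X)
  ∈ₚ? x X = x ∈? proj₁ X

  ∈-𝟎⁻ : ∀ {x} → x ∈ₚ 𝟎 → x ≡ ε
  ∈-𝟎⁻ = x∈⁅y⁆⇒x≡y ε

  ≈𝟎-intro : ∀ X → (∀ {x} → x ∈ₚ X → x ≡ ε) → X ≈ 𝟎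
  ≈𝟎-intro X X⊆𝟎 = ⊆-antisym (λ x∈X → subst (_∈ₚ 𝟎) (sym (X⊆𝟎 x∈X)) (x∈⁅x⁆ ε))
                             (λ x∈𝟎 → subst (_∈ₚ X) (sym (∈-𝟎⁻ x∈𝟎)) (proj₂ X))

  ∈-sumset⁺ : ∀ {A B x y} → x ∈ A → y ∈ B → x ∙ y ∈ sumset G A B
  ∈-sumset⁺ {A} {B} {x} {y} x∈A y∈B = ∈-tabulate⁺ (anyFin-intro _ x (anyFin-intro _ y
    (∧-true⁺ ([]=⇒lookup x∈A) (∧-true⁺ ([]=⇒lookup y∈B) (isYes-true⁺ (x ∙ y ≟ x ∙ y) refl)))))

  ∈-sumset⁻ : ∀ A B {z} → z ∈ sumset G A B → ∃₂ λ x y → x ∈ A × y ∈ B × z ≡ x ∙ y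
  ∈-sumset⁻ A B {z} z∈ with anyFin-elim _ (∈-tabulate⁻ z∈)
  ... | x , any≡true with anyFin-elim _ any≡true
  ...   | y , entry≡true with ∧-true⁻ (lookup A x) entry≡true
  ...     | x∈A , rest with ∧-true⁻ (lookup B y) rest
  ...       | y∈B , z≡xy = x , y , lookup⇒[]= x A x∈A , lookup⇒[]= y B y∈B , isYes-true⁻ (z ≟ x ∙ y) z≡xy

  ∈-⊕⁻ : ∀ X Y {z} → z ∈ₚ X ⊕ Y → ∃₂ λ x y → x ∈ₚ X × y ∈ₚ Y × z ≡ x ∙ y
  ∈-⊕⁻ X Y = ∈-sumset⁻ (proj₁ X) (proj₁ Y)

  ∈-⊕ˡ : ∀ {A} (Y : 𝒫) {x} → x ∈ A → x ∈ sumset G A (proj₁ Y)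
  ∈-⊕ˡ {A} Y x∈A = subst (_∈ sumset G A (proj₁ Y)) (identityʳ _) (∈-sumset⁺ x∈A (proj₂ Y))

  ∈-⊕ʳ : ∀ (X : 𝒫) {B y} → y ∈ B → y ∈ sumset G (proj₁ X) B
  ∈-⊕ʳ X {B} y∈B = subst (_∈ sumset G (proj₁ X) B) (identityˡ _) (∈-sumset⁺ (proj₂ X) y∈B)

  ⊕-identityʳ : ∀ X → X ⊕ 𝟎 ≈ X
  ⊕-identityʳ X = ⊆-antisym ⊆X (∈-⊕ˡ 𝟎)
    where
    ⊆X : ∀ {z} → z ∈ₚ X ⊕ 𝟎 → z ∈ₚ X
    ⊆X z∈ with ∈-⊕⁻ X 𝟎 z∈
    ... | x , w , x∈X , w∈𝟎 , refl = subst (_∈ₚ X) (sym (trans (cong (x ∙_) (∈-𝟎⁻ w∈𝟎)) (identityʳ x))) x∈X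

  whole : 𝒫
  whole = ⊤ , ∈⊤

  ⊕-zeroʳ : ∀ X → X ⊕ whole ≈ whole
  ⊕-zeroʳ X = ⊆-antisym (λ _ → ∈⊤) (∈-⊕ʳ X)

  ⊕-zeroˡ : ∀ X → whole ⊕ X ≈ whole
  ⊕-zeroˡ X = ⊆-antisym (λ _ → ∈⊤) (∈-⊕ˡ X)

  _∣_ : 𝒫 → 𝒫 → Set
  X ∣ Y = ∃ λ Z → X ⊕ Z ≈ Y

  ∣⇒⊆ : ∀ X Y → X ∣ Y → proj₁ X ⊆ proj₁ Y
  ∣⇒⊆ X Y (Z , X⊕Z≈Y) = ⊆-reflexive X⊕Z≈Y ∘ ∈-⊕ˡ Z

  nonzero-element : ∀ X → ¬ X ≈ 𝟎 → ∃ λ x → x ∈ₚ X × x ≢ ε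
  nonzero-element X X≉𝟎 with any? (λ x → ∈ₚ? x X ×-dec ¬? (x ≟ ε))
  ... | yes found = found
  ... | no none = contradiction
    (≈𝟎-intro X λ {x} x∈X → decidable-stable (x ≟ ε) λ x≢ε → none (x , x∈X , x≢ε)) X≉𝟎

  missing-element : ∀ X → ¬ X ≈ whole → ∃ λ g → g ∉ₚ X
  missing-element X X≉whole with any? (λ g → ¬? (∈ₚ? g X))
  ... | yes found = found
  ... | no none = contradiction
    (⊆-antisym (λ _ → ∈⊤) (λ {x} _ → decidable-stable (∈ₚ? x X) (λ x∉X → none (x , x∉X)))) X≉whole

  pair : Fin n → 𝒫
  pair a = ⁅ ε ⁆ ∪ ⁅ a ⁆ , x∈p∪q⁺ (inj₁ (x∈⁅x⁆ ε))

  ∈-pair⁻ : ∀ {a x} → x ∈ₚ pair a → x ≡ ε ⊎ x ≡ a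
  ∈-pair⁻ {a} x∈ = Sum.map (x∈⁅y⁆⇒x≡y ε) (x∈⁅y⁆⇒x≡y a) (x∈p∪q⁻ ⁅ ε ⁆ ⁅ a ⁆ x∈)

  a∈pair : ∀ a → a ∈ₚ pair a
  a∈pair a = x∈p∪q⁺ (inj₂ (x∈⁅x⁆ a))

  pair-injective : ∀ {a b} → pair a ≈ pair b → a ≡ b
  pair-injective {a} {b} pair≈pair with ∈-pair⁻ (subst (a ∈_) pair≈pair (a∈pair a))
  ... | inj₂ a≡b = a≡b
  ... | inj₁ refl = sym (Sum.reduce (∈-pair⁻ (subst (b ∈_) (sym pair≈pair) (a∈pair b))))

  pair≉𝟎 : ∀ {a} → a ≢ ε → ¬ pair a ≈ 𝟎
  pair≉𝟎 {a} a≢ε pair≈𝟎 = a≢ε (∈-𝟎⁻ (subst (a ∈_) pair≈𝟎 (a∈pair a)))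

  ∈-⊕-pair⁻ : ∀ X d {g} → g ∈ₚ X ⊕ pair d → g ∈ₚ X ⊎ g ∙ d ⁻¹ ∈ₚ X
  ∈-⊕-pair⁻ X d g∈ with ∈-⊕⁻ X (pair d) g∈
  ... | x , w , x∈X , w∈pair , refl with ∈-pair⁻ w∈pair
  ...   | inj₁ refl = inj₁ (subst (_∈ₚ X) (sym (identityʳ x)) x∈X)
  ...   | inj₂ refl = inj₂ (subst (_∈ₚ X) (x≈z//y x d _ refl) x∈X)

  ∈-pair⊕pair⁻ : ∀ a b {z} → z ∈ₚ pair a ⊕ pair b → z ≡ ε ⊎ z ≡ a ⊎ z ≡ b ⊎ z ≡ a ∙ b
  ∈-pair⊕pair⁻ a b z∈ with ∈-⊕⁻ (pair a) (pair b) z∈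
  ... | x , w , x∈ , w∈ , refl with ∈-pair⁻ x∈ | ∈-pair⁻ w∈
  ...   | inj₁ refl | inj₁ refl = inj₁ (identityˡ ε)
  ...   | inj₁ refl | inj₂ refl = inj₂ (inj₂ (inj₁ (identityˡ b)))
  ...   | inj₂ refl | inj₁ refl = inj₂ (inj₁ (identityʳ a))
  ...   | inj₂ refl | inj₂ refl = inj₂ (inj₂ (inj₂ refl))

  coatom : (g : Fin n) → g ≢ ε → 𝒫
  coatom g g≢ε = ∁ ⁅ g ⁆ , x∉p⇒x∈∁p (x≢y⇒x∉⁅y⁆ (g≢ε ∘ sym))

  ∈-coatom⁺ : ∀ {g x : Fin n} → x ≢ g → x ∈ ∁ ⁅ g ⁆
  ∈-coatom⁺ = x∉p⇒x∈∁p ∘ x≢y⇒x∉⁅y⁆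

  ∈-coatom⁻ : ∀ {g x : Fin n} → x ∈ ∁ ⁅ g ⁆ → x ≢ g
  ∈-coatom⁻ = x∉⁅y⁆⇒x≢y ∘ x∈∁p⇒x∉p

  coatom-injective : ∀ {g h : Fin n} → ∁ ⁅ g ⁆ ≡ ∁ ⁅ h ⁆ → g ≡ h
  coatom-injective {g} {h} eq =
    decidable-stable (g ≟ h) λ g≢h → ∈-coatom⁻ (subst (h ∈_) eq (∈-coatom⁺ (g≢h ∘ sym))) refl

  Maximal : 𝒫 → Set
  Maximal X = ¬ X ≈ whole × ∀ Z → ¬ Z ≈ 𝟎 → X ⊕ Z ≈ whole

  coatom-maximal : ∀ g g≢ε → Maximal (coatom g g≢ε)
  coatom-maximal g g≢ε = (λ eq → ∈-coatom⁻ (subst (g ∈_) (sym eq) ∈⊤) refl) , fills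
    where
    fills : ∀ Z → ¬ Z ≈ 𝟎 → coatom g g≢ε ⊕ Z ≈ whole
    fills Z Z≉𝟎 with nonzero-element Z Z≉𝟎
    ... | z , z∈Z , z≢ε = ⊆-antisym (λ _ → ∈⊤) (λ {w} _ → reach w)
      where
      reach : ∀ w → w ∈ₚ coatom g g≢ε ⊕ Z
      reach w with w ≟ g
      ... | no w≢g = ∈-⊕ˡ Z (∈-coatom⁺ w≢g)
      ... | yes refl = subst (_∈ₚ coatom g g≢ε ⊕ Z) (//-rightDividesˡ z g)
        (∈-sumset⁺ (∈-coatom⁺ (x∙y≢x g (z≢ε ∘ ⁻¹≡ε⇒≡ε))) z∈Z)

  maximal⇒coatom : ∀ X → Maximal X → ∃₂ λ g (g≢ε : g ≢ ε) → X ≈ coatom g g≢ε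
  maximal⇒coatom X (X≉whole , fills) = g , g≢ε , ⊆-antisym
    (λ x∈X → ∈-coatom⁺ λ x≡g → g∉X (subst (_∈ₚ X) x≡g x∈X))
    (λ {z} z∈ → decidable-stable (∈ₚ? z X) (z∈X (∈-coatom⁻ z∈)))
    where
    g = proj₁ (missing-element X X≉whole)
    g∉X = proj₂ (missing-element X X≉whole)
    g≢ε : g ≢ ε
    g≢ε g≡ε = g∉X (subst (_∈ₚ X) (sym g≡ε) (proj₂ X))
    z∈X : ∀ {z} → z ≢ g → ¬ z ∉ₚ X
    z∈X {z} z≢g z∉X with ∈-⊕-pair⁻ X d (subst (g ∈_) (sym (fills (pair d) (pair≉𝟎 d≢ε))) ∈⊤)
      where
      d = z ⁻¹ ∙ g
      d≢ε : d ≢ ε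
      d≢ε d≡ε = z≢g (trans (sym (identityʳ z)) (trans (cong (z ∙_) (sym d≡ε)) (\\-leftDividesˡ z g)))
    ... | inj₁ g∈X = g∉X g∈X
    ... | inj₂ gd⁻¹∈X = z∉X (subst (_∈ₚ X) (sym (x≈z//y z (z ⁻¹ ∙ g) g (\\-leftDividesˡ z g))) gd⁻¹∈X)

  -- Periods and aperiodic elements

  -- k ∙ X ⊆ X; as X is finite this already forces k ∙ X = X (see period-⁻¹).
  IsPeriod : Fin n → 𝒫 → Set
  IsPeriod k X = ∀ {x} → x ∈ₚ X → k ∙ x ∈ₚ X

  Aperiodic : 𝒫 → Set
  Aperiodic X = ∀ W → W ⊕ X ≈ X → W ≈ 𝟎

  aperiodic⇒period≡ε : ∀ X → Aperiodic X → ∀ {k} → IsPeriod k X → k ≡ ε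
  aperiodic⇒period≡ε X X-aperiodic {k} k-period =
    ∈-𝟎⁻ (subst (k ∈_) (X-aperiodic (pair k) (⊆-antisym ⊆X (∈-⊕ʳ (pair k)))) (a∈pair k))
    where
    ⊆X : proj₁ (pair k ⊕ X) ⊆ proj₁ X
    ⊆X z∈ with ∈-⊕⁻ (pair k) X z∈
    ... | w , x , w∈pair , x∈X , refl with ∈-pair⁻ w∈pair
    ...   | inj₁ refl = subst (_∈ₚ X) (sym (identityˡ x)) x∈X
    ...   | inj₂ refl = k-period x∈X

  period≡ε⇒aperiodic : ∀ X → (∀ {k} → IsPeriod k X → k ≡ ε) → Aperiodic X
  period≡ε⇒aperiodic X periods≡ε W W⊕X≈X = ≈𝟎-intro W λ w∈W →
    periods≡ε λ x∈X → subst (_ ∈_) W⊕X≈X (∈-sumset⁺ w∈W x∈X)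

  isPeriod? : ∀ k X → Dec (IsPeriod k X)
  isPeriod? k X = map′ (λ period {x} → period x) (λ period x → period)
    (all? λ x → ∈ₚ? x X →-dec ∈ₚ? (k ∙ x) X)

  period-or-witness : ∀ k X → IsPeriod k X ⊎ ∃ λ x → x ∈ₚ X × k ∙ x ∉ₚ X
  period-or-witness k X with any? (λ x → ∈ₚ? x X ×-dec ¬? (∈ₚ? (k ∙ x) X))
  ... | yes witness = inj₂ witness
  ... | no none = inj₁ λ {x} x∈X → decidable-stable (∈ₚ? (k ∙ x) X) λ kx∉X → none (x , x∈X , kx∉X)

  aperiodic-or-period : ∀ X → Aperiodic X ⊎ ∃ λ h → h ≢ ε × IsPeriod h X
  aperiodic-or-period X with any? (λ h → ¬? (h ≟ ε) ×-dec isPeriod? h X)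
  ... | yes period = inj₂ period
  ... | no none = inj₁ (period≡ε⇒aperiodic X λ {k} k-period →
    decidable-stable (k ≟ ε) λ k≢ε → none (k , k≢ε , k-period))

  period-· : ∀ {k} X → IsPeriod k X → ∀ m → IsPeriod (m · k) X
  period-· X k-period zero    x∈X = subst (_∈ₚ X) (sym (identityˡ _)) x∈X
  period-· X k-period (suc m) x∈X = subst (_∈ₚ X) (sym (assoc _ _ _)) (k-period (period-· X k-period m x∈X))

  inverse-is-multiple : ∀ k → ∃ λ m → m · k ≡ k ⁻¹
  inverse-is-multiple k with pigeonhole (n<1+n n) (λ i → toℕ i · k)
  ... | i , j , i<j , iₖ≡jₖ with m≤n⇒∃[o]m+o≡n i<j
  ...   | o , i+1+o≡j = o , inverseʳ-unique k (o · k) (identityʳ-unique (toℕ i · k) (suc o · k) (begin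
    toℕ i · k ∙ suc o · k   ≡⟨ ×-homo-+ k (toℕ i) (suc o) ⟨
    (toℕ i + suc o) · k     ≡⟨ cong (_· k) (trans (+-suc (toℕ i) o) i+1+o≡j) ⟩
    toℕ j · k               ≡⟨ iₖ≡jₖ ⟨
    toℕ i · k               ∎))
    where open ≡-Reasoning

  period-⁻¹ : ∀ {k} X → IsPeriod k X → IsPeriod (k ⁻¹) X
  period-⁻¹ {k} X k-period with inverse-is-multiple k
  ... | m , m·k≡k⁻¹ = subst (λ g → IsPeriod g X) m·k≡k⁻¹ (period-· X k-period m)

  period-⊕ : ∀ {k} X Y → IsPeriod k X → IsPeriod k (X ⊕ Y)
  period-⊕ X Y k-period z∈ with ∈-⊕⁻ X Y z∈
  ... | x , y , x∈X , y∈Y , refl = subst (_∈ₚ X ⊕ Y) (assoc _ x y) (∈-sumset⁺ (k-period x∈X) y∈Y)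

  period-resp-≈ : ∀ {k} X Y → X ≈ Y → IsPeriod k X → IsPeriod k Y
  period-resp-≈ X Y X≈Y k-period y∈Y = subst (_ ∈_) X≈Y (k-period (subst (_ ∈_) (sym X≈Y) y∈Y))

  aperiodic-∣-coatom : ∀ Z → Aperiodic Z → ∀ g (g≢ε : g ≢ ε) → g ∉ₚ Z → Z ∣ coatom g g≢ε
  aperiodic-∣-coatom Z Z-aperiodic g g≢ε g∉Z = Y , ⊆-antisym ⊆coatom coatom⊆
    where
    Y : 𝒫
    Y = satisfying (λ y → ¬? (∈ₚ? (g ∙ y ⁻¹) Z)) ,
        ∈-satisfying⁺ _ λ gε⁻¹∈Z → g∉Z (subst (_∈ₚ Z) (trans (cong (g ∙_) ε⁻¹≈ε) (identityʳ g)) gε⁻¹∈Z)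

    ⊆coatom : proj₁ (Z ⊕ Y) ⊆ ∁ ⁅ g ⁆
    ⊆coatom z∈ with ∈-⊕⁻ Z Y z∈
    ... | x , y , x∈Z , y∈Y , refl = ∈-coatom⁺ λ xy≡g →
      ∈-satisfying⁻ _ y∈Y (subst (_∈ₚ Z) (x≈z//y x y g xy≡g) x∈Z)

    coatom⊆ : ∁ ⁅ g ⁆ ⊆ proj₁ (Z ⊕ Y)
    coatom⊆ {h} h∈ with period-or-witness (g ∙ h ⁻¹) Z
    ... | inj₁ k-period =
      contradiction (x∙y⁻¹≈ε⇒x≈y g h (aperiodic⇒period≡ε Z Z-aperiodic k-period)) (∈-coatom⁻ h∈ ∘ sym)
    ... | inj₂ (x , x∈Z , kx∉Z) = subst (_∈ₚ Z ⊕ Y) x∙y≡h (∈-sumset⁺ x∈Z y∈Y)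
      where
      k = g ∙ h ⁻¹
      y = h ∙ x ⁻¹
      x∙y≡h : x ∙ y ≡ h
      x∙y≡h = trans (comm x y) (//-rightDividesˡ x h)
      g∙y⁻¹≡k∙x : g ∙ y ⁻¹ ≡ k ∙ x
      g∙y⁻¹≡k∙x = ∙-cancelʳ y _ _ (trans (//-rightDividesˡ y g)
        (sym (trans (assoc k x y) (trans (cong (k ∙_) x∙y≡h) (//-rightDividesˡ h g)))))
      y∈Y : y ∈ₚ Y
      y∈Y = ∈-satisfying⁺ _ λ gy⁻¹∈Z → kx∉Z (subst (_∈ₚ Z) g∙y⁻¹≡k∙x gy⁻¹∈Z)

  delete : ∀ X c → c ≢ ε → 𝒫
  delete X c c≢ε = proj₁ X ∩ ∁ ⁅ c ⁆ , x∈p∩q⁺ (proj₂ X , ∈-coatom⁺ (c≢ε ∘ sym))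

  ∈-delete⁺ : ∀ X {c} c≢ε {x} → x ∈ₚ X → x ≢ c → x ∈ₚ delete X c c≢ε
  ∈-delete⁺ X c≢ε x∈X x≢c = x∈p∩q⁺ (x∈X , ∈-coatom⁺ x≢c)

  ∈-delete⁻ : ∀ X {c} c≢ε {x} → x ∈ₚ delete X c c≢ε → x ∈ₚ X × x ≢ c
  ∈-delete⁻ X {c} c≢ε x∈ = Product.map₂ ∈-coatom⁻ (x∈p∩q⁻ (proj₁ X) (∁ ⁅ c ⁆) x∈)

  module DeleteTranslate (X : 𝒫) {h} (h≢ε : h ≢ ε) (h-period : IsPeriod h X)
                         {d} (d∈X : d ∈ₚ X) (dh≢ε : d ∙ h ≢ ε) where

    A : 𝒫
    A = delete X (d ∙ h) dh≢ε

    A⊕pair≈X : A ⊕ pair h ≈ X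
    A⊕pair≈X = ⊆-antisym ⊆X X⊆
      where
      ⊆X : proj₁ (A ⊕ pair h) ⊆ proj₁ X
      ⊆X z∈ with ∈-⊕⁻ A (pair h) z∈
      ... | a , w , a∈A , w∈pair , refl with ∈-pair⁻ w∈pair
      ...   | inj₁ refl = subst (_∈ₚ X) (sym (identityʳ a)) (proj₁ (∈-delete⁻ X dh≢ε a∈A))
      ...   | inj₂ refl = subst (_∈ₚ X) (comm h a) (h-period (proj₁ (∈-delete⁻ X dh≢ε a∈A)))
      X⊆ : proj₁ X ⊆ proj₁ (A ⊕ pair h)
      X⊆ {z} z∈X with z ≟ d ∙ h
      ... | no z≢c = ∈-⊕ˡ (pair h) (∈-delete⁺ X dh≢ε z∈X z≢c)
      ... | yes refl = ∈-sumset⁺ (∈-delete⁺ X dh≢ε d∈X (x∙y≢x d h≢ε ∘ sym)) (a∈pair h)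

    -- A period k ≠ ε of A is one of A ⊕ {ε, h} = X, hence so is k⁻¹; then k⁻¹ ∙ c ∈ A for the
    -- deleted point c = d ∙ h, and k ∙ (k⁻¹ ∙ c) = c ∉ A.
    A-aperiodic : Aperiodic A
    A-aperiodic = period≡ε⇒aperiodic A λ {k} k-period → decidable-stable (k ≟ ε) λ k≢ε →
      proj₂ (∈-delete⁻ X dh≢ε (k-period (e∈A k-period k≢ε))) (\\-leftDividesˡ k _)
      where
      c∈X : d ∙ h ∈ₚ X
      c∈X = subst (_∈ₚ X) (comm h d) (h-period d∈X)
      e∈A : ∀ {k} → IsPeriod k A → k ≢ ε → k ⁻¹ ∙ (d ∙ h) ∈ₚ A
      e∈A {k} k-period k≢ε = ∈-delete⁺ X dh≢ε
        (period-⁻¹ X (period-resp-≈ (A ⊕ pair h) X A⊕pair≈X (period-⊕ A (pair h) k-period)) c∈X)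
        (k≢ε ∘ ⁻¹≡ε⇒≡ε ∘ identityˡ-unique (k ⁻¹) (d ∙ h))

  translates-in-pair⇒pair : ∀ X {y h} → y ∈ₚ X → h ≢ ε →
                       (∀ {d} → d ∈ₚ X → d ∙ h ≡ ε ⊎ d ∙ h ≡ y) → Involution y × X ≈ pair y
  translates-in-pair⇒pair X {y} {h} y∈X h≢ε translates = (y≢ε , y∙y≡ε) , ⊆-antisym X⊆pair pair⊆X
    where
    h≡y : h ≡ y
    h≡y with translates (proj₂ X)
    ... | inj₁ εh≡ε = contradiction (trans (sym (identityˡ h)) εh≡ε) h≢ε
    ... | inj₂ εh≡y = trans (sym (identityˡ h)) εh≡y
    y≢ε : y ≢ ε
    y≢ε = h≢ε ∘ trans h≡y
    y∙y≡ε : y ∙ y ≡ ε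
    y∙y≡ε with translates y∈X
    ... | inj₁ yh≡ε = subst (λ t → y ∙ t ≡ ε) h≡y yh≡ε
    ... | inj₂ yh≡y = contradiction (subst (λ t → y ∙ t ≡ y) h≡y yh≡y) (x∙y≢x y y≢ε)
    X⊆pair : proj₁ X ⊆ proj₁ (pair y)
    X⊆pair {z} z∈X with translates z∈X
    ... | inj₁ zh≡ε = subst (_∈ₚ pair y) (sym z≡y) (a∈pair y)
      where
      z≡y : z ≡ y
      z≡y = trans (inverseˡ-unique z h zh≡ε) (trans (cong _⁻¹ h≡y) (involution-selfInverse y∙y≡ε))
    ... | inj₂ zh≡y = subst (_∈ₚ pair y) (sym (identityˡ-unique z h (trans zh≡y (sym h≡y)))) (proj₂ (pair y))
    pair⊆X : proj₁ (pair y) ⊆ proj₁ X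
    pair⊆X z∈ with ∈-pair⁻ z∈
    ... | inj₁ refl = proj₂ X
    ... | inj₂ refl = y∈X

  -- If X has a period h ≠ ε, delete from X a translate d ∙ h ∉ {ε, y}; what remains is an
  -- aperiodic divisor of X. Only X = {ε, y} with y an involution admits no such translate.
  aperiodic-divisor-through : ∀ X {y} → y ∈ₚ X →
    (∃ λ A → Aperiodic A × A ∣ X × y ∈ₚ A) ⊎ (Involution y × X ≈ pair y)
  aperiodic-divisor-through X {y} y∈X with aperiodic-or-period X
  ... | inj₁ X-aperiodic = inj₁ (X , X-aperiodic , (𝟎 , ⊕-identityʳ X) , y∈X)
  ... | inj₂ (h , h≢ε , h-period)
    with any? (λ d → ∈ₚ? d X ×-dec ¬? (d ∙ h ≟ ε) ×-dec ¬? (d ∙ h ≟ y))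
  ...   | yes (d , d∈X , dh≢ε , dh≢y) =
    inj₁ (A , A-aperiodic , (pair h , A⊕pair≈X) , ∈-delete⁺ X dh≢ε y∈X (dh≢y ∘ sym))
    where open DeleteTranslate X h≢ε h-period d∈X dh≢ε
  ...   | no none = inj₂ (translates-in-pair⇒pair X y∈X h≢ε translates)
    where
    translates : ∀ {d} → d ∈ₚ X → d ∙ h ≡ ε ⊎ d ∙ h ≡ y
    translates {d} d∈X with d ∙ h ≟ ε | d ∙ h ≟ y
    ... | yes dh≡ε | _        = inj₁ dh≡ε
    ... | no _     | yes dh≡y = inj₂ dh≡y
    ... | no dh≢ε  | no dh≢y  = contradiction (d , d∈X , dh≢ε , dh≢y) none

  -- Two-element subgroups and the Klein four-group

  -- The subgroups {ε, y}, y an involution, described in the language of the monoid 𝒫 alone, so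
  -- that automorphisms of 𝒫 preserve them.
  OrderTwoSubgroup : 𝒫 → Set
  OrderTwoSubgroup X = ¬ X ≈ 𝟎 × X ⊕ X ≈ X × ∀ W → W ⊕ X ≈ X → W ≈ 𝟎 ⊎ W ≈ X

  pair-orderTwoSubgroup : ∀ {y} → Involution y → OrderTwoSubgroup (pair y)
  pair-orderTwoSubgroup {y} (y≢ε , y∙y≡ε) =
    pair≉𝟎 y≢ε , ⊆-antisym closed (∈-⊕ˡ (pair y)) , absorbed
    where
    closed : proj₁ (pair y ⊕ pair y) ⊆ proj₁ (pair y)
    closed z∈ with ∈-⊕⁻ (pair y) (pair y) z∈
    ... | a , b , a∈ , b∈ , refl with ∈-pair⁻ a∈ | ∈-pair⁻ b∈
    ...   | inj₁ refl | _         = subst (_∈ₚ pair y) (sym (identityˡ b)) b∈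
    ...   | inj₂ refl | inj₁ refl = subst (_∈ₚ pair y) (sym (identityʳ y)) (a∈pair y)
    ...   | inj₂ refl | inj₂ refl = subst (_∈ₚ pair y) (sym y∙y≡ε) (proj₂ (pair y))
    absorbed : ∀ W → W ⊕ pair y ≈ pair y → W ≈ 𝟎 ⊎ W ≈ pair y
    absorbed W W⊕pair≈pair with ∈ₚ? y W
    ... | yes y∈W = inj₂ (⊆-antisym W⊆pair λ z∈ →
      Sum.[ (λ { refl → proj₂ W }) , (λ { refl → y∈W }) ] (∈-pair⁻ z∈))
      where
      W⊆pair : proj₁ W ⊆ proj₁ (pair y)
      W⊆pair = ⊆-reflexive W⊕pair≈pair ∘ ∈-⊕ˡ (pair y)
    ... | no y∉W = inj₁ (≈𝟎-intro W λ w∈W → Sum.[ id , (λ { refl → contradiction w∈W y∉W }) ]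
                                          (∈-pair⁻ (⊆-reflexive W⊕pair≈pair (∈-⊕ˡ (pair y) w∈W))))

  orderTwoSubgroup⇒pair : ∀ X → OrderTwoSubgroup X → ∃ λ y → Involution y × X ≈ pair y
  orderTwoSubgroup⇒pair X (X≉𝟎 , X⊕X≈X , absorbed) with nonzero-element X X≉𝟎
  ... | y , y∈X , y≢ε with absorbed (pair y) (⊆-antisym pair⊕X⊆X (∈-⊕ʳ (pair y)))
    where
    pair⊕X⊆X : proj₁ (pair y ⊕ X) ⊆ proj₁ X
    pair⊕X⊆X z∈ with ∈-⊕⁻ (pair y) X z∈
    ... | w , x , w∈ , x∈X , refl with ∈-pair⁻ w∈
    ...   | inj₁ refl = subst (_∈ₚ X) (sym (identityˡ x)) x∈X
    ...   | inj₂ refl = subst (_ ∈_) X⊕X≈X (∈-sumset⁺ y∈X x∈X)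
  ... | inj₁ pair≈𝟎 = contradiction pair≈𝟎 (pair≉𝟎 y≢ε)
  ... | inj₂ pair≈X = y , (y≢ε , y∙y≡ε) , sym pair≈X
    where
    y∙y≡ε : y ∙ y ≡ ε
    y∙y≡ε with ∈-pair⁻ (subst (_ ∈_) (sym pair≈X) (subst (_ ∈_) X⊕X≈X (∈-sumset⁺ y∈X y∈X)))
    ... | inj₁ yy≡ε = yy≡ε
    ... | inj₂ yy≡y = contradiction yy≡y (x∙y≢x y y≢ε)

  pair-aperiodic : ∀ {c} → c ≢ ε → c ∙ c ≢ ε → Aperiodic (pair c)
  pair-aperiodic {c} c≢ε cc≢ε = period≡ε⇒aperiodic (pair c) λ {k} k-period →
    period≡ε k-period (∈-pair⁻ (subst (_∈ₚ pair c) (identityʳ k) (k-period (proj₂ (pair c)))))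
    where
    period≡ε : ∀ {k} → IsPeriod k (pair c) → k ≡ ε ⊎ k ≡ c → k ≡ ε
    period≡ε k-period (inj₁ k≡ε) = k≡ε
    period≡ε k-period (inj₂ refl) with ∈-pair⁻ (k-period (a∈pair c))
    ... | inj₁ cc≡ε = contradiction cc≡ε cc≢ε
    ... | inj₂ cc≡c = contradiction cc≡c (x∙y≢x c c≢ε)

  module KleinFourSpan {y c} (y-involution : Involution y) (c-involution : Involution c)
                       (c≢y : c ≢ y) (spanning : ∀ b → b ∈ₚ pair y ⊕ pair c) where
    open AbelianGroup KleinFour using () renaming (_∙_ to _⊗_)

    power : Bool → Fin n → Fin n
    power false g = ε
    power true  g = g

    power-xor : ∀ {g} → g ∙ g ≡ ε → ∀ a b → power (a xor b) g ≡ power a g ∙ power b g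
    power-xor g∙g≡ε false b     = sym (identityˡ _)
    power-xor g∙g≡ε true  false = sym (identityʳ _)
    power-xor g∙g≡ε true  true  = sym g∙g≡ε

    embed : Bool × Bool → Fin n
    embed (a , b) = power a y ∙ power b c

    embed-hom : ∀ p q → embed (p ⊗ q) ≡ embed p ∙ embed q
    embed-hom (a , b) (a′ , b′) = trans
      (cong₂ _∙_ (power-xor (proj₂ y-involution) a a′) (power-xor (proj₂ c-involution) b b′))
      (interchange _ _ _ _)

    embed-kernel : ∀ p → embed p ≡ ε → p ≡ (false , false)
    embed-kernel (false , false) _  = refl
    embed-kernel (true  , false) eq = contradiction (trans (sym (identityʳ y)) eq) (proj₁ y-involution)
    embed-kernel (false , true)  eq = contradiction (trans (sym (identityˡ c)) eq) (proj₁ c-involution)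
    embed-kernel (true  , true)  eq =
      contradiction (trans (inverseʳ-unique y c eq) (involution-selfInverse (proj₂ y-involution))) c≢y

    xor≡false⇒≡ : ∀ a b → a xor b ≡ false → a ≡ b
    xor≡false⇒≡ false false _ = refl
    xor≡false⇒≡ true  true  _ = refl

    embed-injective : ∀ p q → embed p ≡ embed q → p ≡ q
    embed-injective (a , b) (a′ , b′) eq with embed-kernel ((a , b) ⊗ (a′ , b′)) (begin
      embed ((a , b) ⊗ (a′ , b′))           ≡⟨ embed-hom (a , b) (a′ , b′) ⟩
      embed (a , b) ∙ embed (a′ , b′)       ≡⟨ cong (_∙ embed (a′ , b′)) eq ⟩
      embed (a′ , b′) ∙ embed (a′ , b′)     ≡⟨ embed-hom (a′ , b′) (a′ , b′) ⟨
      embed ((a′ , b′) ⊗ (a′ , b′))         ≡⟨ cong₂ (λ s t → embed (s , t)) (xor-same a′) (xor-same b′) ⟩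
      ε ∙ ε                                 ≡⟨ identityˡ ε ⟩
      ε                                     ∎)
      where open ≡-Reasoning
    ... | aa′≡false,bb′≡false = cong₂ _,_ (xor≡false⇒≡ a a′ (cong proj₁ aa′≡false,bb′≡false))
                                          (xor≡false⇒≡ b b′ (cong proj₂ aa′≡false,bb′≡false))

    decode : Fin n → Bool × Bool
    decode b with ∈-pair⊕pair⁻ y c (spanning b)
    ... | inj₁ _               = false , false
    ... | inj₂ (inj₁ _)        = true  , false
    ... | inj₂ (inj₂ (inj₁ _)) = false , true
    ... | inj₂ (inj₂ (inj₂ _)) = true  , true

    embed-decode : ∀ b → embed (decode b) ≡ b
    embed-decode b with ∈-pair⊕pair⁻ y c (spanning b)
    ... | inj₁ refl               = identityˡ ε
    ... | inj₂ (inj₁ refl)        = identityʳ y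
    ... | inj₂ (inj₂ (inj₁ refl)) = identityˡ c
    ... | inj₂ (inj₂ (inj₂ refl)) = refl

    decode-embed : ∀ p → decode (embed p) ≡ p
    decode-embed p = embed-injective _ p (embed-decode (embed p))

    decode-hom : ∀ a b → decode (a ∙ b) ≡ decode a ⊗ decode b
    decode-hom a b = embed-injective _ _ (begin
      embed (decode (a ∙ b))                 ≡⟨ embed-decode (a ∙ b) ⟩
      a ∙ b                                  ≡⟨ cong₂ _∙_ (embed-decode a) (embed-decode b) ⟨
      embed (decode a) ∙ embed (decode b)    ≡⟨ embed-hom (decode a) (decode b) ⟨
      embed (decode a ⊗ decode b)            ∎)
      where open ≡-Reasoning

    isomorphism : GroupIso G KleinFour
    isomorphism = record
      { φ     = decode
      ; φ-hom = λ a b → ≡⇒≡×≡ (decode-hom a b)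
      ; φ-bij = (λ {a} {b} eq → trans (sym (embed-decode a)) (trans (cong embed (≡×≡⇒≡ eq)) (embed-decode b)))
              , λ p → embed p , λ {a} a≡embed → ≡⇒≡×≡ (trans (cong decode a≡embed) (decode-embed p))
      }

  module _ (π : Permutation′ n) where
    private
      τ = π ⟨$⟩ʳ_

    image-sumset : (∀ x y → τ (x ∙ y) ≡ τ x ∙ τ y) →
                   ∀ A B → image π (sumset G A B) ≡ sumset G (image π A) (image π B)
    image-sumset τ-hom A B = ⊆-antisym ⊆sum sum⊆
      where
      ⊆sum : image π (sumset G A B) ⊆ sumset G (image π A) (image π B)
      ⊆sum z∈ with ∈-sumset⁻ A B (∈-image⁻ π (sumset G A B) z∈)
      ... | a , b , a∈A , b∈B , τ⁻¹z≡ab = subst (_∈ sumset G (image π A) (image π B))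
        (trans (sym (τ-hom a b)) (trans (cong τ (sym τ⁻¹z≡ab)) (Perm.inverseʳ π)))
        (∈-sumset⁺ (∈-image-apply π a∈A) (∈-image-apply π b∈B))
      sum⊆ : sumset G (image π A) (image π B) ⊆ image π (sumset G A B)
      sum⊆ z∈ with ∈-sumset⁻ (image π A) (image π B) z∈
      ... | a , b , a∈ , b∈ , refl = ∈-image⁺ π (subst (_∈ sumset G A B)
        (⟨$⟩ʳ-injective π (trans (τ-hom _ _)
          (trans (cong₂ _∙_ (Perm.inverseʳ π) (Perm.inverseʳ π)) (sym (Perm.inverseʳ π)))))
        (∈-sumset⁺ (∈-image⁻ π A a∈) (∈-image⁻ π B b∈)))

    module _ (τε≡ε : τ ε ≡ ε) where

      ε∈image : ∀ X → ε ∈ image π (proj₁ X)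
      ε∈image X = subst (_∈ image π (proj₁ X)) τε≡ε (∈-image-apply π {proj₁ X} (proj₂ X))

      image-pair : ∀ a → image π (proj₁ (pair a)) ≡ proj₁ (pair (τ a))
      image-pair a = ⊆-antisym ⊆pair pair⊆
        where
        ⊆pair : image π (proj₁ (pair a)) ⊆ proj₁ (pair (τ a))
        ⊆pair {z} z∈ with ∈-pair⁻ (∈-image⁻ π (proj₁ (pair a)) z∈)
        ... | inj₁ τ⁻¹z≡ε = subst (_∈ₚ pair (τ a))
          (trans (sym τε≡ε) (trans (cong τ (sym τ⁻¹z≡ε)) (Perm.inverseʳ π))) (proj₂ (pair (τ a)))
        ... | inj₂ τ⁻¹z≡a = subst (_∈ₚ pair (τ a))
          (trans (cong τ (sym τ⁻¹z≡a)) (Perm.inverseʳ π)) (a∈pair (τ a))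
        pair⊆ : proj₁ (pair (τ a)) ⊆ image π (proj₁ (pair a))
        pair⊆ z∈ with ∈-pair⁻ z∈
        ... | inj₁ refl = ε∈image (pair a)
        ... | inj₂ refl = ∈-image-apply π (a∈pair a)

      image-𝟎 : image π (proj₁ 𝟎) ≡ proj₁ 𝟎
      image-𝟎 = ≈𝟎-intro (image π (proj₁ 𝟎) , ε∈image 𝟎) λ z∈ →
        trans (sym (Perm.inverseʳ π)) (trans (cong τ (∈-𝟎⁻ (∈-image⁻ π (proj₁ 𝟎) z∈))) τε≡ε)

      module _ (pairs : ∀ x y → image π (proj₁ (pair x ⊕ pair y)) ≡ proj₁ (pair (τ x) ⊕ pair (τ y))) where

        τ-of-product : ∀ {x y} → x ≢ ε → y ≢ ε → τ (x ∙ y) ≡ ε ⊎ τ (x ∙ y) ≡ τ x ∙ τ y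
        τ-of-product {x} {y} x≢ε y≢ε with ∈-pair⊕pair⁻ (τ x) (τ y)
          (subst (τ (x ∙ y) ∈_) (pairs x y) (∈-image-apply π (∈-sumset⁺ (a∈pair x) (a∈pair y))))
        ... | inj₁ τxy≡ε                   = inj₁ τxy≡ε
        ... | inj₂ (inj₁ τxy≡τx)           = contradiction (⟨$⟩ʳ-injective π τxy≡τx) (x∙y≢x x y≢ε)
        ... | inj₂ (inj₂ (inj₁ τxy≡τy))    =
          contradiction (identityˡ-unique x y (⟨$⟩ʳ-injective π τxy≡τy)) x≢ε
        ... | inj₂ (inj₂ (inj₂ τxy≡τxτy))  = inj₂ τxy≡τxτy

        -- Below, w stands for π ⟨$⟩ˡ (τ x ∙ τ y).
        product-of-τ : ∀ {x y} → x ≢ ε → y ≢ ε → τ x ∙ τ y ≡ ε ⊎ τ x ∙ τ y ≡ τ (x ∙ y)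
        product-of-τ {x} {y} x≢ε y≢ε with ∈-pair⊕pair⁻ x y (∈-image⁻ π (proj₁ (pair x ⊕ pair y))
          (subst (τ x ∙ τ y ∈_) (sym (pairs x y)) (∈-sumset⁺ (a∈pair (τ x)) (a∈pair (τ y)))))
        ... | inj₁ w≡ε               = inj₁ (trans (sym (Perm.inverseʳ π)) (trans (cong τ w≡ε) τε≡ε))
        ... | inj₂ (inj₁ w≡x)        = contradiction
          (⟨$⟩ʳ-injective π (trans (identityʳ-unique (τ x) (τ y) (trans (sym (Perm.inverseʳ π)) (cong τ w≡x)))
                                   (sym τε≡ε))) y≢ε
        ... | inj₂ (inj₂ (inj₁ w≡y)) = contradiction
          (⟨$⟩ʳ-injective π (trans (identityˡ-unique (τ x) (τ y) (trans (sym (Perm.inverseʳ π)) (cong τ w≡y)))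
                                   (sym τε≡ε))) x≢ε
        ... | inj₂ (inj₂ (inj₂ w≡xy)) = inj₂ (trans (sym (Perm.inverseʳ π)) (cong τ w≡xy))

        pairs-determine-homomorphism : ∀ x y → τ (x ∙ y) ≡ τ x ∙ τ y
        pairs-determine-homomorphism x y with x ≟ ε | y ≟ ε
        ... | yes refl | _        =
          trans (cong τ (identityˡ y)) (sym (trans (cong (_∙ τ y) τε≡ε) (identityˡ (τ y))))
        ... | no _     | yes refl =
          trans (cong τ (identityʳ x)) (sym (trans (cong (τ x ∙_) τε≡ε) (identityʳ (τ x))))
        ... | no x≢ε | no y≢ε with τ-of-product x≢ε y≢ε | product-of-τ x≢ε y≢ε
        ...   | inj₂ τxy≡τxτy | _             = τxy≡τxτy
        ...   | inj₁ τxy≡ε    | inj₁ τxτy≡ε   = trans τxy≡ε (sym τxτy≡ε)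
        ...   | inj₁ _        | inj₂ τxτy≡τxy = sym τxτy≡τxy

  -- Automorphisms of 𝒫 and the permutation they induce on G

  module _ (Φ : AutP₀ G) where

    F⁻¹ : 𝒫 → 𝒫
    F⁻¹ Y = proj₁ (proj₂ (F-bij Φ) Y)

    F∘F⁻¹ : ∀ Y → F Φ (F⁻¹ Y) ≈ Y
    F∘F⁻¹ Y = proj₂ (proj₂ (F-bij Φ) Y) refl

    F-injective : ∀ X Y → F Φ X ≈ F Φ Y → X ≈ Y
    F-injective X Y = proj₁ (F-bij Φ) {X} {Y}

    F⁻¹∘F : ∀ X → F⁻¹ (F Φ X) ≈ X
    F⁻¹∘F X = F-injective _ X (F∘F⁻¹ (F Φ X))

    F-≉𝟎 : ∀ X → ¬ X ≈ 𝟎 → ¬ F Φ X ≈ 𝟎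
    F-≉𝟎 X X≉𝟎 FX≈𝟎 = X≉𝟎 (F-injective X 𝟎 (trans FX≈𝟎 (sym (F-id Φ))))

    F⁻¹-≉𝟎 : ∀ W → ¬ W ≈ 𝟎 → ¬ F⁻¹ W ≈ 𝟎
    F⁻¹-≉𝟎 W W≉𝟎 F⁻¹W≈𝟎 = W≉𝟎 (trans (sym (F∘F⁻¹ W)) (trans (F-cong Φ _ 𝟎 F⁻¹W≈𝟎) (F-id Φ)))

    F-whole : F Φ whole ≈ whole
    F-whole = begin
      proj₁ (F Φ whole)                       ≡⟨ F-cong Φ _ _ (sym (⊕-zeroˡ (F⁻¹ whole))) ⟩
      proj₁ (F Φ (whole ⊕ F⁻¹ whole))         ≡⟨ F-hom Φ whole (F⁻¹ whole) ⟩
      proj₁ (F Φ whole ⊕ F Φ (F⁻¹ whole))     ≡⟨ cong (sumset G (proj₁ (F Φ whole))) (F∘F⁻¹ whole) ⟩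
      proj₁ (F Φ whole ⊕ whole)               ≡⟨ ⊕-zeroʳ (F Φ whole) ⟩
      proj₁ whole                             ∎
      where open ≡-Reasoning

    F-∣ : ∀ A B → A ∣ B → F Φ A ∣ F Φ B
    F-∣ A B (Z , A⊕Z≈B) = F Φ Z , trans (sym (F-hom Φ A Z)) (F-cong Φ _ _ A⊕Z≈B)

    F-maximal : ∀ X → Maximal X → Maximal (F Φ X)
    F-maximal X (X≉whole , fills) =
      (λ FX≈whole → X≉whole (F-injective X whole (trans FX≈whole (sym F-whole)))) ,
      λ Z Z≉𝟎 → begin
        proj₁ (F Φ X ⊕ Z)                  ≡⟨ cong (sumset G (proj₁ (F Φ X))) (F∘F⁻¹ Z) ⟨
        proj₁ (F Φ X ⊕ F Φ (F⁻¹ Z))        ≡⟨ F-hom Φ X (F⁻¹ Z) ⟨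
        proj₁ (F Φ (X ⊕ F⁻¹ Z))            ≡⟨ F-cong Φ _ _ (fills (F⁻¹ Z) (F⁻¹-≉𝟎 Z Z≉𝟎)) ⟩
        proj₁ (F Φ whole)                  ≡⟨ F-whole ⟩
        proj₁ whole                        ∎
      where open ≡-Reasoning

    absorbs-preimage : ∀ W X → W ⊕ F Φ X ≈ F Φ X → F⁻¹ W ⊕ X ≈ X
    absorbs-preimage W X W⊕FX≈FX = F-injective _ X (begin
      proj₁ (F Φ (F⁻¹ W ⊕ X))            ≡⟨ F-hom Φ (F⁻¹ W) X ⟩
      proj₁ (F Φ (F⁻¹ W) ⊕ F Φ X)        ≡⟨ cong (λ A → sumset G A (proj₁ (F Φ X))) (F∘F⁻¹ W) ⟩
      proj₁ (W ⊕ F Φ X)                  ≡⟨ W⊕FX≈FX ⟩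
      proj₁ (F Φ X)                      ∎)
      where open ≡-Reasoning

    F-aperiodic : ∀ X → Aperiodic X → Aperiodic (F Φ X)
    F-aperiodic X X-aperiodic W W⊕FX≈FX = trans (sym (F∘F⁻¹ W))
      (trans (F-cong Φ _ 𝟎 (X-aperiodic (F⁻¹ W) (absorbs-preimage W X W⊕FX≈FX))) (F-id Φ))

    F-orderTwoSubgroup : ∀ X → OrderTwoSubgroup X → OrderTwoSubgroup (F Φ X)
    F-orderTwoSubgroup X (X≉𝟎 , X⊕X≈X , absorbed) =
      F-≉𝟎 X X≉𝟎 , trans (sym (F-hom Φ X X)) (F-cong Φ _ _ X⊕X≈X) , absorbed′
      where
      absorbed′ : ∀ W → W ⊕ F Φ X ≈ F Φ X → W ≈ 𝟎 ⊎ W ≈ F Φ X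
      absorbed′ W W⊕FX≈FX with absorbed (F⁻¹ W) (absorbs-preimage W X W⊕FX≈FX)
      ... | inj₁ F⁻¹W≈𝟎 = inj₁ (trans (sym (F∘F⁻¹ W)) (trans (F-cong Φ _ 𝟎 F⁻¹W≈𝟎) (F-id Φ)))
      ... | inj₂ F⁻¹W≈X = inj₂ (trans (sym (F∘F⁻¹ W)) (F-cong Φ _ X F⁻¹W≈X))

  inverse : AutP₀ G → AutP₀ G
  inverse Φ = record
    { F      = F⁻¹ Φ
    ; F-cong = λ X Y X≈Y → F-injective Φ _ _ (trans (F∘F⁻¹ Φ X) (trans X≈Y (sym (F∘F⁻¹ Φ Y))))
    ; F-hom  = λ X Y → F-injective Φ _ _ (begin
        proj₁ (F Φ (F⁻¹ Φ (X ⊕ Y)))                 ≡⟨ F∘F⁻¹ Φ (X ⊕ Y) ⟩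
        sumset G (proj₁ X) (proj₁ Y)                 ≡⟨ cong₂ (sumset G) (F∘F⁻¹ Φ X) (F∘F⁻¹ Φ Y) ⟨
        proj₁ (F Φ (F⁻¹ Φ X) ⊕ F Φ (F⁻¹ Φ Y))       ≡⟨ F-hom Φ (F⁻¹ Φ X) (F⁻¹ Φ Y) ⟨
        proj₁ (F Φ (F⁻¹ Φ X ⊕ F⁻¹ Φ Y))             ∎)
    ; F-id   = F-injective Φ _ _ (trans (F∘F⁻¹ Φ 𝟎) (sym (F-id Φ)))
    ; F-bij  = (λ {X} {Y} F⁻¹X≈F⁻¹Y → trans (sym (F∘F⁻¹ Φ X)) (trans (F-cong Φ _ _ F⁻¹X≈F⁻¹Y) (F∘F⁻¹ Φ Y)))
             , λ Y → F Φ Y , λ {Z} Z≈FY → F-injective Φ _ _ (trans (F∘F⁻¹ Φ Z) Z≈FY)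
    }
    where open ≡-Reasoning

  coatom-image : ∀ Φ g (g≢ε : g ≢ ε) → ∃₂ λ h (h≢ε : h ≢ ε) → F Φ (coatom g g≢ε) ≈ coatom h h≢ε
  coatom-image Φ g g≢ε = maximal⇒coatom (F Φ (coatom g g≢ε)) (F-maximal Φ _ (coatom-maximal g g≢ε))

  τ : AutP₀ G → Fin n → Fin n
  τ Φ g with g ≟ ε
  ... | yes _   = ε
  ... | no g≢ε = proj₁ (coatom-image Φ g g≢ε)

  τ-ε : ∀ Φ → τ Φ ε ≡ ε
  τ-ε Φ with ε ≟ ε
  ... | yes _   = refl
  ... | no ε≢ε = contradiction refl ε≢ε

  F-coatom : ∀ Φ g (g≢ε : g ≢ ε) → proj₁ (F Φ (coatom g g≢ε)) ≡ ∁ ⁅ τ Φ g ⁆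
  F-coatom Φ g g≢ε with g ≟ ε
  ... | yes g≡ε  = contradiction g≡ε g≢ε
  ... | no g≢ε′ = trans (F-cong Φ _ _ refl) (proj₂ (proj₂ (coatom-image Φ g g≢ε′)))

  τ-≢ε : ∀ Φ {g} (g≢ε : g ≢ ε) → τ Φ g ≢ ε
  τ-≢ε Φ {g} g≢ε τg≡ε =
    ∈-coatom⁻ (subst (ε ∈_) (F-coatom Φ g g≢ε) (proj₂ (F Φ (coatom g g≢ε)))) (sym τg≡ε)

  τ-leftInverse : ∀ Φ Ψ → (∀ X → F Ψ (F Φ X) ≈ X) → ∀ g → τ Ψ (τ Φ g) ≡ g
  τ-leftInverse Φ Ψ Ψ∘Φ≈id g = by-cases g (g ≟ ε)
    where
    open ≡-Reasoning
    by-cases : ∀ g → Dec (g ≡ ε) → τ Ψ (τ Φ g) ≡ g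
    by-cases _ (yes refl) = trans (cong (τ Ψ) (τ-ε Φ)) (τ-ε Ψ)
    by-cases g (no g≢ε)  = coatom-injective (begin
      ∁ ⁅ τ Ψ (τ Φ g) ⁆                             ≡⟨ F-coatom Ψ (τ Φ g) (τ-≢ε Φ g≢ε) ⟨
      proj₁ (F Ψ (coatom (τ Φ g) (τ-≢ε Φ g≢ε)))     ≡⟨ F-cong Ψ _ _ (sym (F-coatom Φ g g≢ε)) ⟩
      proj₁ (F Ψ (F Φ (coatom g g≢ε)))              ≡⟨ Ψ∘Φ≈id (coatom g g≢ε) ⟩
      ∁ ⁅ g ⁆                                       ∎)

  τ-permutation : AutP₀ G → Permutation′ n
  τ-permutation Φ = Perm.permutation (τ Φ) (τ (inverse Φ))
    (τ-leftInverse (inverse Φ) Φ (F∘F⁻¹ Φ)) (τ-leftInverse Φ (inverse Φ) (F⁻¹∘F Φ))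

  F≡τ-image : ∀ Φ X → (∀ {g} → g ∈ₚ X → τ Φ g ∈ₚ F Φ X) → (∀ {g} → τ Φ g ∈ₚ F Φ X → g ∈ₚ X) →
              proj₁ (F Φ X) ≡ image (τ-permutation Φ) (proj₁ X)
  F≡τ-image Φ X forward backward = ⊆-antisym
    (λ y∈ → ∈-image⁺ π (backward (subst (_∈ₚ F Φ X) (sym (Perm.inverseʳ π)) y∈)))
    (λ y∈ → subst (_∈ₚ F Φ X) (Perm.inverseʳ π) (forward (∈-image⁻ π (proj₁ X) y∈)))
    where π = τ-permutation Φ

  ∈-F-aperiodic⁻ : ∀ Φ Z → Aperiodic Z → ∀ {g} → τ Φ g ∈ₚ F Φ Z → g ∈ₚ Z
  ∈-F-aperiodic⁻ Φ Z Z-aperiodic {g} τg∈FZ = decidable-stable (∈ₚ? g Z) λ g∉Z →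
    let g≢ε : g ≢ ε
        g≢ε g≡ε = g∉Z (subst (_∈ₚ Z) (sym g≡ε) (proj₂ Z))
        FZ⊆Fcoatom = ∣⇒⊆ (F Φ Z) (F Φ (coatom g g≢ε))
          (F-∣ Φ Z _ (aperiodic-∣-coatom Z Z-aperiodic g g≢ε g∉Z))
    in ∈-coatom⁻ (subst (τ Φ g ∈_) (F-coatom Φ g g≢ε) (FZ⊆Fcoatom τg∈FZ)) refl

  ∈-F-aperiodic⁺ : ∀ Φ Z → Aperiodic Z → ∀ {g} → g ∈ₚ Z → τ Φ g ∈ₚ F Φ Z
  ∈-F-aperiodic⁺ Φ Z Z-aperiodic {g} g∈Z =
    ∈-F-aperiodic⁻ (inverse Φ) (F Φ Z) (F-aperiodic Φ Z Z-aperiodic)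
      (subst₂ _∈_ (sym (τ-leftInverse Φ (inverse Φ) (F⁻¹∘F Φ) g)) (sym (F⁻¹∘F Φ Z)) g∈Z)

  F-pair-aperiodic : ∀ Φ {c} → c ≢ ε → c ∙ c ≢ ε → F Φ (pair c) ≈ pair (τ Φ c)
  F-pair-aperiodic Φ {c} c≢ε cc≢ε = trans
    (F≡τ-image Φ (pair c) (∈-F-aperiodic⁺ Φ _ pair-ap) (∈-F-aperiodic⁻ Φ _ pair-ap))
    (image-pair (τ-permutation Φ) (τ-ε Φ) c)
    where
    pair-ap = pair-aperiodic c≢ε cc≢ε

  ∈-F⁺-or-exceptional : ∀ Φ X {g} → g ∈ₚ X → τ Φ g ∈ₚ F Φ X ⊎ (Involution g × X ≈ pair g)
  ∈-F⁺-or-exceptional Φ X g∈X with aperiodic-divisor-through X g∈X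
  ... | inj₂ exceptional = inj₂ exceptional
  ... | inj₁ (A , A-aperiodic , A∣X , g∈A) =
    inj₁ (∣⇒⊆ (F Φ A) (F Φ X) (F-∣ Φ A X A∣X) (∈-F-aperiodic⁺ Φ A A-aperiodic g∈A))

  module _ (not-klein : ¬ GroupIso G KleinFour) where

    -- With c = τ⁻¹ k ≠ y: if c is an involution, then every b lies in {ε, y} ⊕ {ε, c} (look at where
    -- Φ⁻¹ sends k ∈ Φ({ε, y} ⊕ {ε, b})) and G is the Klein four-group; otherwise {ε, c} is
    -- aperiodic and Φ{ε, c} = {ε, k} = Φ{ε, y}.
    involution-preimage : ∀ Φ {y k} → Involution y → Involution k → F Φ (pair y) ≈ pair k →
                          τ (inverse Φ) k ≡ y
    involution-preimage Φ {y} {k} y-involution k-involution F[y]≈[k] =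
      decidable-stable (c ≟ y) λ c≢y → refute c≢y (c ∙ c ≟ ε)
      where
      c = τ (inverse Φ) k

      τc≡k : τ Φ c ≡ k
      τc≡k = Perm.inverseʳ (τ-permutation Φ)

      c≢ε : c ≢ ε
      c≢ε c≡ε = proj₁ k-involution (trans (sym τc≡k) (trans (cong (τ Φ) c≡ε) (τ-ε Φ)))

      k∈F[y⊕b] : ∀ b → k ∈ₚ F Φ (pair y ⊕ pair b)
      k∈F[y⊕b] b = ∣⇒⊆ (F Φ (pair y)) (F Φ (pair y ⊕ pair b)) (F-∣ Φ (pair y) _ (pair b , refl))
                       (subst (k ∈_) (sym F[y]≈[k]) (a∈pair k))

      spanning : c ≢ y → ∀ b → b ∈ₚ pair y ⊕ pair c
      spanning c≢y b with ∈-F⁺-or-exceptional (inverse Φ) (F Φ (pair y ⊕ pair b)) (k∈F[y⊕b] b)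
      ... | inj₂ (_ , F[y⊕b]≈[k]) = ∈-⊕ˡ (pair c) (subst (b ∈_) [y⊕b]≈[y] (∈-⊕ʳ (pair y) (a∈pair b)))
        where
        [y⊕b]≈[y] : pair y ⊕ pair b ≈ pair y
        [y⊕b]≈[y] = F-injective Φ (pair y ⊕ pair b) (pair y) (trans F[y⊕b]≈[k] (sym F[y]≈[k]))
      ... | inj₁ c∈ with ∈-pair⊕pair⁻ y b (subst (c ∈_) (F⁻¹∘F Φ (pair y ⊕ pair b)) c∈)
      ...   | inj₁ c≡ε               = contradiction c≡ε c≢ε
      ...   | inj₂ (inj₁ c≡y)        = contradiction c≡y c≢y
      ...   | inj₂ (inj₂ (inj₁ c≡b)) = subst (_∈ₚ pair y ⊕ pair c) c≡b (∈-⊕ʳ (pair y) (a∈pair c))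
      ...   | inj₂ (inj₂ (inj₂ c≡yb)) =
        subst (_∈ₚ pair y ⊕ pair c) (sym b≡yc) (∈-sumset⁺ (a∈pair y) (a∈pair c))
        where
        b≡yc : b ≡ y ∙ c
        b≡yc = trans (y≈x\\z y b c (sym c≡yb)) (cong (_∙ c) (involution-selfInverse (proj₂ y-involution)))

      refute : c ≢ y → Dec (c ∙ c ≡ ε) → ⊥
      refute c≢y (yes cc≡ε) =
        not-klein (KleinFourSpan.isomorphism y-involution (c≢ε , cc≡ε) c≢y (spanning c≢y))
      refute c≢y (no cc≢ε)  = c≢y (pair-injective (F-injective Φ (pair c) (pair y)
        (trans (F-pair-aperiodic Φ c≢ε cc≢ε) (trans (cong (proj₁ ∘ pair) τc≡k) (sym F[y]≈[k])))))

    F-pair-involution : ∀ Φ {y} → Involution y → F Φ (pair y) ≈ pair (τ Φ y)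
    F-pair-involution Φ {y} y-involution with orderTwoSubgroup⇒pair (F Φ (pair y))
      (F-orderTwoSubgroup Φ (pair y) (pair-orderTwoSubgroup y-involution))
    ... | k , k-involution , F[y]≈[k] = trans F[y]≈[k] (cong (proj₁ ∘ pair) (begin
      k                        ≡⟨ Perm.inverseʳ (τ-permutation Φ) ⟨
      τ Φ (τ (inverse Φ) k)    ≡⟨ cong (τ Φ) (involution-preimage Φ y-involution k-involution F[y]≈[k]) ⟩
      τ Φ y                    ∎))
      where open ≡-Reasoning

    ∈-F⁺ : ∀ Φ X {g} → g ∈ₚ X → τ Φ g ∈ₚ F Φ X
    ∈-F⁺ Φ X {g} g∈X with ∈-F⁺-or-exceptional Φ X g∈X
    ... | inj₁ τg∈FX = τg∈FX
    ... | inj₂ (g-involution , X≈[g]) = subst (τ Φ g ∈_)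
      (sym (trans (F-cong Φ X (pair g) X≈[g]) (F-pair-involution Φ g-involution))) (a∈pair (τ Φ g))

    -- The reverse inclusion is the forward one for the inverse automorphism.
    F-image : ∀ Φ X → proj₁ (F Φ X) ≡ image (τ-permutation Φ) (proj₁ X)
    F-image Φ X = F≡τ-image Φ X (∈-F⁺ Φ X) λ {g} τg∈FX →
      subst₂ _∈_ (τ-leftInverse Φ (inverse Φ) (F⁻¹∘F Φ) g) (F⁻¹∘F Φ X) (∈-F⁺ (inverse Φ) (F Φ X) τg∈FX)

    τ-homomorphism : ∀ Φ x y → τ Φ (x ∙ y) ≡ τ Φ x ∙ τ Φ y
    τ-homomorphism Φ = pairs-determine-homomorphism π (τ-ε Φ) λ x y → begin
      image π (proj₁ (pair x ⊕ pair y))                          ≡⟨ F-image Φ (pair x ⊕ pair y) ⟨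
      proj₁ (F Φ (pair x ⊕ pair y))                              ≡⟨ F-hom Φ (pair x) (pair y) ⟩
      sumset G (proj₁ (F Φ (pair x))) (proj₁ (F Φ (pair y)))     ≡⟨ cong₂ (sumset G) (F-pair x) (F-pair y) ⟩
      proj₁ (pair (τ Φ x) ⊕ pair (τ Φ y))                        ∎
      where
      open ≡-Reasoning
      π = τ-permutation Φ
      F-pair : ∀ x → proj₁ (F Φ (pair x)) ≡ proj₁ (pair (τ Φ x))
      F-pair x = trans (F-image Φ (pair x)) (image-pair π (τ-ε Φ) x)

    τ-automorphism : AutP₀ G → AutG G
    τ-automorphism Φ = record
      { f     = τ Φ
      ; f-hom = τ-homomorphism Φ
      ; f-bij = ⟨$⟩ʳ-injective π , λ h → π ⟨$⟩ˡ h , λ z≡ → trans (cong (τ Φ) z≡) (Perm.inverseʳ π)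
      }
      where π = τ-permutation Φ

  -- Automorphisms of G acting on 𝒫

  module _ (σ : AutG G) where

    permutation-of : Permutation′ n
    permutation-of = ⤖⇒↔ (mk⤖ (f-bij σ))

    σ-ε : f σ ε ≡ ε
    σ-ε = identityʳ-unique (f σ ε) (f σ ε) (trans (sym (f-hom σ ε ε)) (cong (f σ) (identityˡ ε)))

    σ⁻¹-ε : permutation-of ⟨$⟩ˡ ε ≡ ε
    σ⁻¹-ε = trans (cong (permutation-of ⟨$⟩ˡ_) (sym σ-ε)) (Perm.inverseˡ permutation-of)

    induced : AutP₀ G
    induced = record
      { F      = λ X → image π (proj₁ X) , ε∈image π σ-ε X
      ; F-cong = λ X Y → cong (image π)
      ; F-hom  = λ X Y → image-sumset π (f-hom σ) (proj₁ X) (proj₁ Y)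
      ; F-id   = image-𝟎 π σ-ε
      ; F-bij  = (λ {X} {Y} image≡image → trans (sym (image-flipˡ π (proj₁ X)))
                   (trans (cong (image (Perm.flip π)) image≡image) (image-flipˡ π (proj₁ Y))))
               , λ Y → (image (Perm.flip π) (proj₁ Y) , ε∈image (Perm.flip π) σ⁻¹-ε Y) ,
                       λ Z≈ → trans (cong (image π) Z≈) (image-flipʳ π (proj₁ Y))
      }
      where π = permutation-of

  induced-injective : ∀ σ ρ → (∀ X → F (induced σ) X ≈ F (induced ρ) X) → ∀ x → f σ x ≡ f ρ x
  induced-injective σ ρ induced≈ x = pair-injective (begin
    proj₁ (pair (f σ x))                       ≡⟨ image-pair (permutation-of σ) (σ-ε σ) x ⟨
    image (permutation-of σ) (proj₁ (pair x))  ≡⟨ induced≈ (pair x) ⟩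
    image (permutation-of ρ) (proj₁ (pair x))  ≡⟨ image-pair (permutation-of ρ) (σ-ε ρ) x ⟩
    proj₁ (pair (f ρ x))                       ∎)
    where open ≡-Reasoning

theorem3p7 : (n : ℕ) (G : FinAbGroup n) → ¬ GroupIso G KleinFour → AutIso G
theorem3p7 n G not-klein = record
  { Θ      = induced G
  ; Θ-cong = λ σ ρ σ≈ρ X → image-cong (permutation-of G σ) (permutation-of G ρ) σ≈ρ (proj₁ X)
  ; Θ-hom  = λ σ ρ σ∘ρ σ∘ρ≈ X → trans
      (image-cong (permutation-of G σ∘ρ) (permutation-of G ρ ∘ₚ permutation-of G σ) σ∘ρ≈ (proj₁ X))
      (image-∘ₚ (permutation-of G ρ) (permutation-of G σ) (proj₁ X))
  ; Θ-inj  = induced-injective G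
  ; Θ-surj = λ Φ → let σ = τ-automorphism G not-klein Φ in σ , λ X → trans
      (image-cong (permutation-of G σ) (τ-permutation G Φ) (λ _ → refl) (proj₁ X))
      (sym (F-image G not-klein Φ X))
  }
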